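{- Let $T^{\natural}=(S^{\natural},I^{\natural},R^{\natural},V^{\natural})$ be an infinite-state transition system with $V^{\natural}=V^{\natural}_{bool}\cup V^{\natural}_{int}$, and let $\varphi=\{\varphi_1,\dots,\varphi_n\}$ be a set of predicates with $V(\varphi)\subseteq V^{\natural}_{int}$. Let $T^{\sharp}=(S^{\sharp},I^{\sharp},R^{\sharp},V^{\sharp})$ be its partially predicate abstracted transition system, i.e. $V^{\sharp}=(V^{\natural}\cup\{b_1,\dots,b_n\})\setminus V(\varphi)$, $S^{\sharp}=\bigcup_{s\in S^{\natural}}\alpha(s)$, $I^{\sharp}=\bigcup_{s\in I^{\natural}}\alpha(s)$, $R^{\sharp}=\bigcup_{r\in R^{\natural}}\alpha^{\tau}(r)$. Then $T^{\sharp}$ approximates $T^{\natural}$ via $\alpha$, i.e. $T^{\natural}\sqsubseteq_{\alpha}T^{\sharp}$: (i) if $s_1\in I^{\natural}$ and $\alpha(s_1)=s_2$ then $s_2\in I^{\sharp}$; (ii) if $(s_1,s_1')\in R^{\natural}$, $\alpha(s_1)=s_2$ and $\alpha(s_1')=s_2'$, then $(s_2,s_2')\in R^{\sharp}$.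
   Context: A transition system (Kripke structure) $T=(S,I,R,V)$ has state variables $V=V_{bool}\cup V_{int}$, state space $S\subseteq\mathcal{B}^{|V_{bool}|}\times\mathcal{Z}^{|V_{int}|}$, initial states $I\subseteq S$ and transition relation $R\subseteq S\times S$. Sets of states/transitions are identified with formulas. $b_1,\dots,b_n$ are fresh boolean variables, $\varphi_i'$ is $\varphi_i$ with all variables primed. Abstraction of states: $\alpha(s)=\exists V(\varphi).(s\wedge\bigwedge_i(\varphi_i\iff b_i))$. Abstraction of transitions: $\alpha^{\tau}(r)=\exists V(\varphi).\exists V(\varphi').(r\wedge CS\wedge\bigwedge_i(\varphi_i\iff b_i)\wedge\bigwedge_i(\varphi_i'\iff b_i'))$ with $CS=\bigwedge_i((\bigwedge_{v\in V(\varphi_i)}v'=v)\implies(b_i'\iff b_i))$. -}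

module Defs where

open import Data.Nat using (ℕ)
open import Data.Bool using (Bool)
open import Data.Integer using (ℤ)
open import Data.Fin using (Fin)
open import Data.List using (List)
open import Data.List.Membership.Propositional using (_∈_)
open import Data.Product using (Σ; ∃; ∃-syntax; _×_; _,_; proj₁; proj₂)
open import Relation.Binary.PropositionalEquality using (_≡_)

record TS (St : Set) : Set₁ where
  field
    S : St → Set
    I : St → Set
    R : St → St → Set
open TS public

-- Valuations of the k integer variables that occur in the predicates.
Val : ℕ → Set
Val k = Fin k → ℤ

-- A predicate φ_i over the integer variables Fin k, together with its set of
-- variables V(φ_i); its truth value depends only on the variables in V(φ_i).
record Pred (k : ℕ) : Set where
  field
    vars  : List (Fin k)
    eval  : Val k → Bool
    local : ∀ (σ τ : Val k) → (∀ v → v ∈ vars → σ v ≡ τ v) → eval σ ≡ eval τ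
open Pred public

-- V(φ) = ⋃ V(φ_i) is exactly the set of abstracted integer variables Fin k.
Covers : ∀ {k n} → (Fin n → Pred k) → Set
Covers {k} {n} φ = ∀ (v : Fin k) → ∃[ i ] (v ∈ vars (φ i))

-- Concrete states: a valuation u : U of the variables V♮ ∖ V(φ) (booleans and
-- the remaining integers) together with a valuation of the integers V(φ).
Conc : Set → ℕ → Set
Conc U k = U × Val k

-- Abstract states: valuation of V♮ ∖ V(φ) together with values of b_1..b_n.
Abs : Set → ℕ → Set
Abs U n = U × (Fin n → Bool)

module _ {U : Set} {k n : ℕ} (φ : Fin n → Pred k) where

  -- α(s) = ∃ V(φ). (s ∧ ⋀ (φ_i ⇔ b_i)) : a is in α(s)
  InAlpha : Conc U k → Abs U n → Set
  InAlpha (u , x) (w , b) = (w ≡ u) × (∀ i → b i ≡ eval (φ i) x)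

  -- For a single concrete state, α(s) is a single abstract state.
  α : Conc U k → Abs U n
  α (u , x) = (u , λ i → eval (φ i) x)

  -- (a , a') ∈ α^τ((s , s')) :
  --   ∃ V(φ) ∃ V(φ'). r ∧ CS ∧ ⋀(φ_i ⇔ b_i) ∧ ⋀(φ_i' ⇔ b_i')
  InAlphaτ : Conc U k → Conc U k → Abs U n → Abs U n → Set
  InAlphaτ (u , x) (u' , x') (w , b) (w' , b') =
    (w ≡ u) × (w' ≡ u')
    × (∀ i → b i ≡ eval (φ i) x)
    × (∀ i → b' i ≡ eval (φ i) x')
    × (∀ i → (∀ v → v ∈ vars (φ i) → x' v ≡ x v) → b' i ≡ b i)

  abstractTS : TS (Conc U k) → TS (Abs U n)
  abstractTS T♮ = record
    { S = λ a → ∃[ s ] (S T♮ s × InAlpha s a)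
    ; I = λ a → ∃[ s ] (I T♮ s × InAlpha s a)
    ; R = λ a a' → ∃[ s ] ∃[ s' ] (R T♮ s s' × InAlphaτ s s' a a')
    }

Approximates : ∀ {C A : Set} → TS C → (C → A) → TS A → Set
Approximates {C} {A} T♮ abs T♯ =
  (∀ (s₁ : C) (s₂ : A) → I T♮ s₁ → abs s₁ ≡ s₂ → I T♯ s₂)
  × (∀ (s₁ s₁' : C) (s₂ s₂' : A) → R T♮ s₁ s₁' → abs s₁ ≡ s₂ → abs s₁' ≡ s₂'
       → R T♯ s₂ s₂')

module Submission where

open import Defs
open import Data.Nat using (ℕ)
open import Data.Fin using (Fin)
open import Data.Product using (_,_)
open import Relation.Binary.PropositionalEquality using (_≡_; refl)

-- Every concrete state s lies over its abstraction α s, and every concrete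
-- transition s → s' over α s → α s'; the frame constraint CS holds because
-- each predicate depends only on its own variables.

module _ {U : Set} {k n : ℕ} (φ : Fin n → Pred k) where

  α-contains-α : (s : Conc U k) → InAlpha φ s (α φ s)
  α-contains-α (u , x) = refl , λ _ → refl

  ατ-contains-α×α : (s s' : Conc U k) → InAlphaτ φ s s' (α φ s) (α φ s')
  ατ-contains-α×α (u , x) (u' , x') =
    refl , refl , (λ _ → refl) , (λ _ → refl) ,
    λ i unchanged → local (φ i) x' x unchanged

lemma6 : ∀ {U : Set} {k n : ℕ} (φ : Fin n → Pred k) → Covers φ
    → (T♮ : TS (Conc U k))
    → Approximates T♮ (α {U} φ) (abstractTS {U} φ T♮)
lemma6 φ _ T♮ = initial , transition
  where
  initial : ∀ s₁ s₂ → I T♮ s₁ → α φ s₁ ≡ s₂ → I (abstractTS φ T♮) s₂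
  initial s₁ _ init refl = s₁ , init , α-contains-α φ s₁

  transition : ∀ s₁ s₁' s₂ s₂' → R T♮ s₁ s₁' → α φ s₁ ≡ s₂ → α φ s₁' ≡ s₂'
             → R (abstractTS φ T♮) s₂ s₂'
  transition s₁ s₁' _ _ step refl refl =
    s₁ , s₁' , step , ατ-contains-α×α φ s₁ s₁'
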